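{- Let $G$ and $H$ be graphs, $v\in V(G)$ and $w\in V(H)$. Then $$\check{\mu}\big((G\sqcup H)+vw\big)=\begin{cases}\check{\mu}(G\sqcup H)-2 & \text{if } G=H=K_1,\\ \check{\mu}(G\sqcup H)-1 & \text{otherwise, if } T(v,G)\text{ and }T(w,H)\text{ hold},\\ \check{\mu}(G\sqcup H) & \text{otherwise.}\end{cases}$$
   Context: All graphs are finite and simple with nonempty vertex set. By convention $K_1$ and $K_2$ are regarded as Hamiltonian (in addition to graphs with a Hamiltonian cycle). $\sqcup$ is disjoint union; $G\ast H$ is the join ($G\sqcup H$ plus all edges between $V(G)$ and $V(H)$); $K_0$ is the empty graph. $\check{\mu}(G)=\min\{l\in\mathbb{N}_0: K_l\ast G\text{ is Hamiltonian}\}$. A path may consist of a single vertex; its terminal vertices are its endpoints. An $s$-path covering of $G$ is a set of $s$ vertex-disjoint paths in $G$ containing every vertex of $G$; $\mu(G)$ is the minimum such $s$, and a minimal path covering is a $\mu(G)$-path covering. For $v\in V(G)$, $T(v,G)$ is the statement that $v$ is a terminal vertex of some path in some minimal path covering of $G$. -}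

module Defs where

open import Data.Nat using (ℕ; zero; suc; _≤_; _<_; _+_)
open import Data.Fin using (Fin; splitAt; _≟_)
open import Data.Bool using (Bool; true; false; not; _∧_)
open import Data.Sum using (_⊎_; inj₁; inj₂)
open import Data.Product using (Σ; _×_; _,_; ∃-syntax)
open import Data.List using (List; []; _∷_; length; concat; allFin)
open import Data.List.Relation.Unary.All using (All)
open import Data.List.Relation.Unary.Any using (Any)
open import Data.List.Relation.Unary.Linked using (Linked)
open import Data.List.Relation.Binary.Permutation.Propositional using (_↭_)
open import Relation.Binary.PropositionalEquality using (_≡_; refl; sym)
open import Relation.Nullary using (¬_; yes; no)
open import Relation.Nullary.Decidable using (⌊_⌋)

record Graph (n : ℕ) : Set where
  field
    adj    : Fin n → Fin n → Bool
    adjSym : ∀ i j → adj i j ≡ adj j i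
    adjIrr : ∀ i → adj i i ≡ false
open Graph public

Adj : ∀ {n} → Graph n → Fin n → Fin n → Set
Adj G i j = adj G i j ≡ true

complete : (l : ℕ) → Graph l
complete l = record { adj = λ i j → not ⌊ i ≟ j ⌋ ; adjSym = s ; adjIrr = r }
  where
  s : ∀ i j → not ⌊ i ≟ j ⌋ ≡ not ⌊ j ≟ i ⌋
  s i j with i ≟ j | j ≟ i
  ... | yes _ | yes _ = refl
  ... | no _  | no _  = refl
  ... | yes p | no q  = Data.Empty.⊥-elim (q (sym p))
    where import Data.Empty
  ... | no p  | yes q = Data.Empty.⊥-elim (p (sym q))
    where import Data.Empty
  r : ∀ i → not ⌊ i ≟ i ⌋ ≡ false
  r i with i ≟ i
  ... | yes _ = refl
  ... | no p  = Data.Empty.⊥-elim (p refl)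
    where import Data.Empty

-- Union of G and H on Fin (m + n) (G's vertices first), with cross edges
-- given by c : an edge between i ∈ V(G) and j ∈ V(H) iff c i j ≡ true.
module _ {m n : ℕ} (G : Graph m) (H : Graph n) (c : Fin m → Fin n → Bool) where
  private
    adjS : Fin m ⊎ Fin n → Fin m ⊎ Fin n → Bool
    adjS (inj₁ i) (inj₁ j) = adj G i j
    adjS (inj₂ i) (inj₂ j) = adj H i j
    adjS (inj₁ i) (inj₂ j) = c i j
    adjS (inj₂ j) (inj₁ i) = c i j
    symS : ∀ x y → adjS x y ≡ adjS y x
    symS (inj₁ i) (inj₁ j) = adjSym G i j
    symS (inj₂ i) (inj₂ j) = adjSym H i j
    symS (inj₁ i) (inj₂ j) = refl
    symS (inj₂ j) (inj₁ i) = refl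
    irrS : ∀ x → adjS x x ≡ false
    irrS (inj₁ i) = adjIrr G i
    irrS (inj₂ i) = adjIrr H i
  unionWith : Graph (m + n)
  unionWith = record
    { adj    = λ i j → adjS (splitAt m i) (splitAt m j)
    ; adjSym = λ i j → symS (splitAt m i) (splitAt m j)
    ; adjIrr = λ i → irrS (splitAt m i) }

_⊔_ : ∀ {m n} → Graph m → Graph n → Graph (m + n)
G ⊔ H = unionWith G H (λ _ _ → false)

_∗_ : ∀ {m n} → Graph m → Graph n → Graph (m + n)
G ∗ H = unionWith G H (λ _ _ → true)

unionPlusEdge : ∀ {m n} → Graph m → Graph n → Fin m → Fin n → Graph (m + n)
unionPlusEdge G H v w = unionWith G H (λ i j → ⌊ i ≟ v ⌋ ∧ ⌊ j ≟ w ⌋)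

lastOf : ∀ {A : Set} → A → List A → A
lastOf x []       = x
lastOf x (y ∷ ys) = lastOf y ys

HamCycle : ∀ {n} → Graph n → Set
HamCycle {n} G = Σ (Fin n) λ x → Σ (List (Fin n)) λ xs →
  ((x ∷ xs) ↭ allFin n) × Linked (Adj G) (x ∷ xs) × Adj G (lastOf x xs) x

-- Hamiltonian, with the convention that K_1 and K_2 are Hamiltonian
Hamiltonian : ∀ {n} → Graph n → Set
Hamiltonian {n} G =
  (n ≡ 1) ⊎ (n ≡ 2 × ∃[ i ] ∃[ j ] Adj G i j) ⊎ (3 ≤ n × HamCycle G)

IsMuCheck : ∀ {n} → Graph n → ℕ → Set
IsMuCheck G l = Hamiltonian (complete l ∗ G)
  × (∀ k → k < l → ¬ Hamiltonian (complete k ∗ G))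

-- a path in G: nonempty sequence of vertices, consecutive ones adjacent
-- (vertex-distinctness is enforced by the covering condition below)
IsPath : ∀ {n} → Graph n → List (Fin n) → Set
IsPath G []       = Data.Empty.⊥ where import Data.Empty
IsPath G (x ∷ xs) = Linked (Adj G) (x ∷ xs)

-- a path covering: paths that are vertex-disjoint and cover all vertices,
-- i.e. their concatenation is a permutation of the vertex list
IsPathCover : ∀ {n} → Graph n → List (List (Fin n)) → Set
IsPathCover {n} G ps = All (IsPath G) ps × (concat ps ↭ allFin n)

IsMinPathCover : ∀ {n} → Graph n → List (List (Fin n)) → Set
IsMinPathCover G ps = IsPathCover G ps
  × (∀ qs → IsPathCover G qs → length ps ≤ length qs)

IsTerminal : ∀ {A : Set} → A → List A → Set
IsTerminal v []       = Data.Empty.⊥ where import Data.Empty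
IsTerminal v (x ∷ xs) = (v ≡ x) ⊎ (v ≡ lastOf x xs)

T : ∀ {n} → Fin n → Graph n → Set
T v G = ∃[ ps ] IsMinPathCover G ps × Any (IsTerminal v) ps

-- For a non-Hamiltonian graph X with at least one vertex, μ̌(X) = μ(X): k ≥ 1 paths covering X,
-- interleaved with the k vertices of K_k, form a Hamiltonian cycle of K_k ∗ X, and deleting K_k
-- from a Hamiltonian cycle of K_k ∗ X leaves at most k paths covering X. In (G ⊔ H) + vw the
-- edge vw is a bridge, so neither this graph nor G ⊔ H is Hamiltonian unless G = H = K₁.
-- A path of (G ⊔ H) + vw stays in G, stays in H, or runs through vw, ending at v in G and
-- starting at w in H, and at most one path runs through vw. Hence μ((G ⊔ H) + vw) is
-- μ(G) + μ(H) or one less, and one less exactly when v and w are terminal vertices of minimal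
-- path coverings of G and H, which can then be joined along vw.

module Submission where

open import Defs
open import Data.Nat using (ℕ; zero; suc; _+_; _≤_; _<_; z≤n; s≤s)
import Data.Nat.Properties as ℕ
import Algebra.Properties.CommutativeSemigroup ℕ.+-commutativeSemigroup as ℕ+
open import Data.Fin as Fin using (Fin; splitAt; join; _↑ˡ_; _↑ʳ_)
open import Data.Fin.Properties using (splitAt-↑ˡ; splitAt-↑ʳ; splitAt-join; join-splitAt; toℕ<n)
open import Data.Bool using (Bool; true; false; _∧_)
open import Data.Sum using (_⊎_; inj₁; inj₂; isInj₁; isInj₂)
open import Data.Product as Prod using (∃; ∃-syntax; _×_; _,_; proj₁; proj₂)
open import Data.List using (List; []; _∷_; _++_; map; concat; concatMap; length; allFin; tabulate; mapMaybe)
import Data.List.Properties as List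
open import Data.List.Relation.Unary.All as All using (All; []; _∷_)
import Data.List.Relation.Unary.All.Properties as Allₚ
open import Data.List.Relation.Unary.Any using (Any; here; there)
import Data.List.Relation.Unary.Any.Properties as Any
open import Data.List.Relation.Unary.Linked as Linked using (Linked; []; [-]; _∷_)
import Data.List.Relation.Unary.Linked.Properties as Linkedₚ
open import Data.List.Relation.Unary.Unique.Propositional using (Unique)
open import Data.List.Relation.Unary.AllPairs using ([]; _∷_)
import Data.List.Relation.Unary.Unique.Propositional.Properties as Unique
open import Data.List.Relation.Binary.Permutation.Propositional
open import Data.List.Relation.Binary.Permutation.Propositional.Properties
import Data.List.Relation.Binary.Permutation.Setoid.Properties as PermutationSetoid
open import Data.List.Membership.Propositional using (_∈_; find)
open import Data.List.Membership.Propositional.Properties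
open import Data.List.Extrema.Nat using (argmin; f[argmin]≤f[xs]; argmin-all)
open import Relation.Binary.PropositionalEquality as ≡ hiding (trans)
open import Relation.Nullary using (¬_; yes; no)
open import Relation.Nullary.Decidable using (⌊_⌋; _×-dec_)
open import Data.Empty using (⊥; ⊥-elim)
open import Function using (_∘_; id)

lastOf-map : ∀ {A B : Set} (f : A → B) x xs → lastOf (f x) (map f xs) ≡ f (lastOf x xs)
lastOf-map f x []       = refl
lastOf-map f x (y ∷ xs) = lastOf-map f y xs

module _ {A : Set} where

  lastOf-++ : ∀ (x : A) xs ys → lastOf x (xs ++ ys) ≡ lastOf (lastOf x xs) ys
  lastOf-++ x []       ys = refl
  lastOf-++ x (y ∷ xs) ys = lastOf-++ y xs ys

  lastOf-∈ : ∀ (x : A) xs → lastOf x xs ∈ x ∷ xs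
  lastOf-∈ x []       = here refl
  lastOf-∈ x (y ∷ xs) = there (lastOf-∈ y xs)

  lastOf≡head⇒[] : ∀ (x : A) xs → Unique (x ∷ xs) → lastOf x xs ≡ x → xs ≡ []
  lastOf≡head⇒[] x []       _           _ = refl
  lastOf≡head⇒[] x (y ∷ xs) (x∉ ∷ _) eq = ⊥-elim (All.lookup x∉ (lastOf-∈ y xs) (sym eq))

  Unique-resp-↭ : ∀ {xs ys : List A} → xs ↭ ys → Unique xs → Unique ys
  Unique-resp-↭ p = PermutationSetoid.Unique-resp-↭ (setoid A) (↭⇒↭ₛ p)

  Unique-++⁻ˡ : ∀ (xs : List A) {ys} → Unique (xs ++ ys) → Unique xs
  Unique-++⁻ˡ []       _         = []
  Unique-++⁻ˡ (x ∷ xs) (x∉ ∷ u) = Allₚ.++⁻ˡ xs x∉ ∷ Unique-++⁻ˡ xs u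

  Unique-++⁻ʳ : ∀ (xs : List A) {ys} → Unique (xs ++ ys) → Unique ys
  Unique-++⁻ʳ []       u       = u
  Unique-++⁻ʳ (x ∷ xs) (_ ∷ u) = Unique-++⁻ʳ xs u

  Unique-++⇒disjoint : ∀ (xs : List A) {ys z} → Unique (xs ++ ys) → z ∈ xs → z ∈ ys → ⊥
  Unique-++⇒disjoint (x ∷ xs) (x∉ ∷ _) (here refl) z∈ys = All.lookup x∉ (∈-++⁺ʳ xs z∈ys) refl
  Unique-++⇒disjoint (x ∷ xs) (_ ∷ u)  (there z∈xs) z∈ys = Unique-++⇒disjoint xs u z∈xs z∈ys

  concat-↭ : ∀ {xss yss : List (List A)} → xss ↭ yss → concat xss ↭ concat yss
  concat-↭ refl           = ↭-refl
  concat-↭ (prep xs p)     = ++⁺ˡ xs (concat-↭ p)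
  concat-↭ (swap xs ys p)  = ↭-trans (shifts xs ys) (++⁺ˡ ys (++⁺ˡ xs (concat-↭ p)))
  concat-↭ (trans p q)     = ↭-trans (concat-↭ p) (concat-↭ q)

  extract : ∀ {P : A → Set} {xs} → Any P xs → ∃ λ y → ∃ λ ys → P y × xs ↭ y ∷ ys
  extract p with find p
  ... | y , y∈xs , py with ∈-∃++ y∈xs
  ...   | as , bs , refl = y , as ++ bs , py , shift y as bs

module _ {A : Set} {R : A → A → Set} where

  Linked-++⁺ : ∀ {x xs y ys} → Linked R (x ∷ xs) → R (lastOf x xs) y → Linked R (y ∷ ys) →
               Linked R (x ∷ xs ++ y ∷ ys)
  Linked-++⁺ {xs = []}    [-]      r l = r ∷ l
  Linked-++⁺ {xs = _ ∷ _} (r′ ∷ l′) r l = r′ ∷ Linked-++⁺ l′ r l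

  Linked-++⁻ : ∀ x xs y ys → Linked R (x ∷ xs ++ y ∷ ys) →
               Linked R (x ∷ xs) × R (lastOf x xs) y × Linked R (y ∷ ys)
  Linked-++⁻ x []       y ys (r ∷ l) = [-] , r , l
  Linked-++⁻ x (z ∷ xs) y ys (r ∷ l) with Linked-++⁻ z xs y ys l
  ... | l₁ , r′ , l₂ = r ∷ l₁ , r′ , l₂

  Linked-reverse : (∀ {a b} → R a b → R b a) → ∀ x xs → Linked R (x ∷ xs) →
                   ∃ λ y → ∃ λ ys → Linked R (y ∷ ys) × y ∷ ys ↭ x ∷ xs
                     × y ≡ lastOf x xs × lastOf y ys ≡ x
  Linked-reverse R-sym x []       [-]     = x , [] , [-] , ↭-refl , refl , refl
  Linked-reverse R-sym x (z ∷ zs) (r ∷ l) with Linked-reverse R-sym z zs l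
  ... | y , ys , l′ , p , y≡last , last≡z =
    y , ys ++ x ∷ [] , Linked-++⁺ l′ (subst (λ t → R t x) (sym last≡z) (R-sym r)) [-] ,
    ↭-trans (++-comm (y ∷ ys) (x ∷ [])) (prep x p) , y≡last , lastOf-++ y ys (x ∷ [])

  rotateCycle : ∀ x xs → Linked R (x ∷ xs) → R (lastOf x xs) x →
                ∀ as y bs → x ∷ xs ≡ as ++ y ∷ bs →
                ∃ λ ys → Linked R (y ∷ ys) × y ∷ ys ↭ x ∷ xs
  rotateCycle x xs l close []       y bs refl = xs , l , ↭-refl
  rotateCycle x xs l close (a ∷ as) y bs refl with Linked-++⁻ a as y bs l
  ... | l₁ , _ , l₂ =
    bs ++ a ∷ as , Linked-++⁺ l₂ (subst (λ t → R t a) (lastOf-++ a as (y ∷ bs)) close) l₁ ,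
    ++-comm (y ∷ bs) (a ∷ as)

Linked-map : ∀ {A B : Set} {R : A → A → Set} {S : B → B → Set} (f : A → B) →
             (∀ {a b} → R a b → S (f a) (f b)) → ∀ {xs} → Linked R xs → Linked S (map f xs)
Linked-map f h = Linkedₚ.map⁺ ∘ Linked.map h

module _ {A : Set} where

  insertions : A → List A → List (List A)
  insertions x []       = (x ∷ []) ∷ []
  insertions x (y ∷ ys) = (x ∷ y ∷ ys) ∷ map (y ∷_) (insertions x ys)

  permutations : List A → List (List A)
  permutations []       = [] ∷ []
  permutations (x ∷ xs) = concatMap (insertions x) (permutations xs)

  ∈-insertions⁻ : ∀ x ys {zs} → zs ∈ insertions x ys → zs ↭ x ∷ ys
  ∈-insertions⁻ x []       (here refl) = ↭-refl
  ∈-insertions⁻ x (y ∷ ys) (here refl) = ↭-refl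
  ∈-insertions⁻ x (y ∷ ys) (there zs∈) with ∈-map⁻ (y ∷_) zs∈
  ... | ws , ws∈ , refl = ↭-trans (prep y (∈-insertions⁻ x ys ws∈)) (swap y x ↭-refl)

  ∈-insertions⁺ : ∀ x as bs → as ++ x ∷ bs ∈ insertions x (as ++ bs)
  ∈-insertions⁺ x []       []       = here refl
  ∈-insertions⁺ x []       (b ∷ bs) = here refl
  ∈-insertions⁺ x (a ∷ as) bs       = there (∈-map⁺ (a ∷_) (∈-insertions⁺ x as bs))

  ∈-permutations⁻ : ∀ xs {zs} → zs ∈ permutations xs → zs ↭ xs
  ∈-permutations⁻ []       (here refl) = ↭-refl
  ∈-permutations⁻ (x ∷ xs) zs∈ with ∈-concat⁻′ (map (insertions x) (permutations xs)) zs∈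
  ... | ys , zs∈ys , ys∈ with ∈-map⁻ (insertions x) ys∈
  ...   | ws , ws∈ , refl = ↭-trans (∈-insertions⁻ x ws zs∈ys) (prep x (∈-permutations⁻ xs ws∈))

  ∈-permutations⁺ : ∀ xs {zs} → zs ↭ xs → zs ∈ permutations xs
  ∈-permutations⁺ []       p rewrite ↭-empty-inv p = here refl
  ∈-permutations⁺ (x ∷ xs) p with ∈-∃++ (∈-resp-↭ (↭-sym p) (here refl))
  ... | as , bs , refl =
    ∈-concat⁺′ (∈-insertions⁺ x as bs)
      (∈-map⁺ (insertions x) (∈-permutations⁺ xs (drop-∷ (↭-trans (↭-sym (shift x as bs)) p))))

module _ {N : ℕ} (X : Graph N) where

  extendRun : Fin N → List (List (Fin N)) → List (List (Fin N))
  extendRun x ((y ∷ r) ∷ rs) with adj X x y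
  ... | true  = (x ∷ y ∷ r) ∷ rs
  ... | false = (x ∷ []) ∷ (y ∷ r) ∷ rs
  extendRun x rs = (x ∷ []) ∷ rs

  maximalRuns : List (Fin N) → List (List (Fin N))
  maximalRuns []       = []
  maximalRuns (x ∷ xs) = extendRun x (maximalRuns xs)

  concat-extendRun : ∀ x rs → concat (extendRun x rs) ≡ x ∷ concat rs
  concat-extendRun x []             = refl
  concat-extendRun x ([] ∷ rs)      = refl
  concat-extendRun x ((y ∷ r) ∷ rs) with adj X x y
  ... | true  = refl
  ... | false = refl

  extendRun-paths : ∀ x {rs} → All (IsPath X) rs → All (IsPath X) (extendRun x rs)
  extendRun-paths x []                        = [-] ∷ []
  extendRun-paths x {(y ∷ r) ∷ rs} (p ∷ ps) with adj X x y in xy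
  ... | true  = (xy ∷ p) ∷ ps
  ... | false = [-] ∷ p ∷ ps

  extendRun-head : ∀ x rs → ∃ λ r → ∃ λ rs′ → extendRun x rs ≡ (x ∷ r) ∷ rs′
  extendRun-head x []             = _ , _ , refl
  extendRun-head x ([] ∷ rs)      = _ , _ , refl
  extendRun-head x ((y ∷ r) ∷ rs) with adj X x y
  ... | true  = _ , _ , refl
  ... | false = _ , _ , refl

  length-extendRun : ∀ x rs → length (extendRun x rs) ≤ suc (length rs)
  length-extendRun x []             = ℕ.≤-refl
  length-extendRun x ([] ∷ rs)      = ℕ.≤-refl
  length-extendRun x ((y ∷ r) ∷ rs) with adj X x y
  ... | true  = ℕ.n≤1+n _
  ... | false = ℕ.≤-refl

  length-extendRun-edge : ∀ {x y} r rs → Adj X x y →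
                          length (extendRun x ((y ∷ r) ∷ rs)) ≡ suc (length rs)
  length-extendRun-edge {x} {y} r rs xy rewrite xy = refl

  concat-maximalRuns : ∀ π → concat (maximalRuns π) ≡ π
  concat-maximalRuns []       = refl
  concat-maximalRuns (x ∷ xs) =
    ≡.trans (concat-extendRun x (maximalRuns xs)) (cong (x ∷_) (concat-maximalRuns xs))

  maximalRuns-paths : ∀ π → All (IsPath X) (maximalRuns π)
  maximalRuns-paths []       = []
  maximalRuns-paths (x ∷ xs) = extendRun-paths x (maximalRuns-paths xs)

  length-maximalRuns-++ : ∀ x xs zs → Linked (Adj X) (x ∷ xs) →
                          length (maximalRuns (x ∷ xs ++ zs)) ≤ suc (length (maximalRuns zs))
  length-maximalRuns-++ x []       zs _        = length-extendRun x (maximalRuns zs)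
  length-maximalRuns-++ x (y ∷ xs) zs (xy ∷ l) with extendRun-head y (maximalRuns (xs ++ zs))
  ... | r , rs , eq = begin
    length (extendRun x (extendRun y (maximalRuns (xs ++ zs))))
      ≡⟨ cong (length ∘ extendRun x) eq ⟩
    length (extendRun x ((y ∷ r) ∷ rs)) ≡⟨ length-extendRun-edge r rs xy ⟩
    suc (length rs)                     ≡⟨ cong length eq ⟨
    length (maximalRuns (y ∷ xs ++ zs)) ≤⟨ length-maximalRuns-++ y xs zs l ⟩
    suc (length (maximalRuns zs))       ∎
    where open ℕ.≤-Reasoning

  length-maximalRuns-concat : ∀ qs → All (IsPath X) qs → length (maximalRuns (concat qs)) ≤ length qs
  length-maximalRuns-concat []              _        = z≤n
  length-maximalRuns-concat ((x ∷ xs) ∷ qs) (l ∷ ls) =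
    ℕ.≤-trans (length-maximalRuns-++ x xs (concat qs) l) (s≤s (length-maximalRuns-concat qs ls))

  -- No path covering has fewer paths than the maximal runs of its own vertex order,
  -- so minimising over all vertex orders gives a minimal path covering.
  minPathCover : ∃ (IsMinPathCover X)
  minPathCover =
    maximalRuns best , (maximalRuns-paths best , subst (_↭ allFin N) (sym (concat-maximalRuns best)) best↭) ,
    λ qs (ps , qs↭) → ℕ.≤-trans (minimal (∈-permutations⁺ (allFin N) qs↭)) (length-maximalRuns-concat qs ps)
    where
    cost : List (Fin N) → ℕ
    cost = length ∘ maximalRuns
    best = argmin cost (allFin N) (permutations (allFin N))
    best↭ : best ↭ allFin N
    best↭ = argmin-all cost ↭-refl (All.tabulate (∈-permutations⁻ (allFin N)))
    minimal : ∀ {π} → π ∈ permutations (allFin N) → cost best ≤ cost π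
    minimal = All.lookup (f[argmin]≤f[xs] (allFin N) (permutations (allFin N)))

[]≭allFin : ∀ {k} → Fin k → ¬ ([] ↭ allFin k)
[]≭allFin i p with ∈-resp-↭ (↭-sym p) (∈-allFin i)
... | ()

1≤size : ∀ {N} → Fin N → 1 ≤ N
1≤size i = ℕ.≤-trans (s≤s z≤n) (toℕ<n i)

+-≤-parts : ∀ {a b c d} → a + b ≤ c + d → c ≤ a → d ≤ b → a ≤ c × b ≤ d
+-≤-parts {a} {b} {c} {d} ab≤cd c≤a d≤b =
  ℕ.+-cancelʳ-≤ d a c (ℕ.≤-trans (ℕ.+-monoʳ-≤ a d≤b) ab≤cd) ,
  ℕ.+-cancelˡ-≤ c b d (ℕ.≤-trans (ℕ.+-monoˡ-≤ b c≤a) ab≤cd)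

pathCover≤1 : ∀ {N} (X : Graph N) → N ≤ 1 → ∃ λ qs → IsPathCover X qs × length qs ≤ 1
pathCover≤1 {zero}        X _ = [] , ([] , ↭-refl) , z≤n
pathCover≤1 {suc zero}    X _ = (Fin.zero ∷ []) ∷ [] , ([-] ∷ [] , ↭-refl) , ℕ.≤-refl
pathCover≤1 {suc (suc _)} X (s≤s ())

module _ {N : ℕ} {X : Graph N} where

  length≤length-concat : ∀ qs → All (IsPath X) qs → length qs ≤ length (concat qs)
  length≤length-concat []              _        = z≤n
  length≤length-concat ((x ∷ xs) ∷ qs) (_ ∷ ps) = s≤s (begin
    length qs                   ≤⟨ length≤length-concat qs ps ⟩
    length (concat qs)          ≤⟨ ℕ.m≤n+m _ (length xs) ⟩
    length xs + length (concat qs) ≡⟨ List.length-++ xs ⟨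
    length (xs ++ concat qs)    ∎)
    where open ℕ.≤-Reasoning

  length-pathCover≤ : ∀ {qs} → IsPathCover X qs → length qs ≤ N
  length-pathCover≤ {qs} (ps , qs↭) =
    ℕ.≤-trans (length≤length-concat qs ps)
      (ℕ.≤-reflexive (≡.trans (↭-length qs↭) (List.length-tabulate id)))

  pathCover-nonempty : ∀ {qs} → IsPathCover X qs → Fin N → 1 ≤ length qs
  pathCover-nonempty {[]}    (_ , qs↭) i = ⊥-elim ([]≭allFin i qs↭)
  pathCover-nonempty {_ ∷ _} _         _ = s≤s z≤n

  minPathCover-≤ : ∀ {ps qs} → IsMinPathCover X ps → IsPathCover X qs → length qs ≤ length ps →
                   IsMinPathCover X qs
  minPathCover-≤ (_ , minimal) cover qs≤ps = cover , λ rs cover′ → ℕ.≤-trans qs≤ps (minimal rs cover′)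

  minimal-lengths : ∀ {ps qs} → IsMinPathCover X ps → IsMinPathCover X qs → length ps ≡ length qs
  minimal-lengths (ps-cover , ps-min) (qs-cover , qs-min) = ℕ.≤-antisym (ps-min _ qs-cover) (qs-min _ ps-cover)

  pathCover-replace : ∀ {qs p rest p′} → IsPathCover X qs → qs ↭ p ∷ rest → p′ ↭ p → IsPath X p′ →
                      IsPathCover X (p′ ∷ rest)
  pathCover-replace (ps , qs↭) qs↭p∷rest p′↭p p′-path with All-resp-↭ qs↭p∷rest ps
  ... | _ ∷ rest-paths =
    p′-path ∷ rest-paths , ↭-trans (++⁺ʳ _ p′↭p) (↭-trans (concat-↭ (↭-sym qs↭p∷rest)) qs↭)

  pathCover-↭ : ∀ {qs qs′} → IsPathCover X qs → qs ↭ qs′ → IsPathCover X qs′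
  pathCover-↭ (ps , qs↭) p = All-resp-↭ p ps , ↭-trans (concat-↭ (↭-sym p)) qs↭

  pathCover-join : ∀ {x xs y ys rest} → IsPathCover X ((x ∷ xs) ∷ (y ∷ ys) ∷ rest) → Adj X (lastOf x xs) y →
                   IsPathCover X ((x ∷ xs ++ y ∷ ys) ∷ rest)
  pathCover-join {x} {xs} {y} {ys} {rest} (l₁ ∷ l₂ ∷ ls , qs↭) e =
    Linked-++⁺ l₁ e l₂ ∷ ls , ↭-trans (↭-reflexive (List.++-assoc (x ∷ xs) (y ∷ ys) (concat rest))) qs↭

  Adj-sym : ∀ {a b} → Adj X a b → Adj X b a
  Adj-sym {a} {b} ab = ≡.trans (adjSym X b a) ab

  Adj-irrefl : ∀ {a} → ¬ Adj X a a
  Adj-irrefl {a} aa with ≡.trans (sym (adjIrr X a)) aa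
  ... | ()

  pathEndingAt : ∀ v p → IsPath X p → IsTerminal v p →
                 ∃ λ a → ∃ λ A → Linked (Adj X) (a ∷ A) × a ∷ A ↭ p × lastOf a A ≡ v
  pathEndingAt v (x ∷ xs) l (inj₂ v≡last) = x , xs , l , ↭-refl , sym v≡last
  pathEndingAt v (x ∷ xs) l (inj₁ v≡x) with Linked-reverse Adj-sym x xs l
  ... | y , ys , l′ , p , _ , last≡x = y , ys , l′ , p , ≡.trans last≡x (sym v≡x)

  pathStartingAt : ∀ w p → IsPath X p → IsTerminal w p →
                   ∃ λ b → ∃ λ B → Linked (Adj X) (b ∷ B) × b ∷ B ↭ p × b ≡ w
  pathStartingAt w (x ∷ xs) l (inj₁ w≡x) = x , xs , l , ↭-refl , sym w≡x
  pathStartingAt w (x ∷ xs) l (inj₂ w≡last) with Linked-reverse Adj-sym x xs l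
  ... | y , ys , l′ , p , y≡last , _ = y , ys , l′ , p , ≡.trans y≡last (sym w≡last)

  -- K₀ ∗ X is X itself up to computation: 0 + N reduces to N and splitAt 0 to inj₂.
  Hamiltonian⇒pathCover≤1 : Hamiltonian (complete 0 ∗ X) → ∃ λ qs → IsPathCover X qs × length qs ≤ 1
  Hamiltonian⇒pathCover≤1 (inj₁ N≡1)                           = pathCover≤1 X (ℕ.≤-reflexive N≡1)
  Hamiltonian⇒pathCover≤1 (inj₂ (inj₁ (refl , i , j , ij)))    = (i ∷ j ∷ []) ∷ [] , edgeCover i j ij , ℕ.≤-refl
    where
    edgeCover : ∀ (i j : Fin 2) → Adj X i j → IsPathCover X ((i ∷ j ∷ []) ∷ [])
    edgeCover Fin.zero           (Fin.suc Fin.zero) ij = (ij ∷ [-]) ∷ [] , ↭-refl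
    edgeCover (Fin.suc Fin.zero) Fin.zero           ij = (ij ∷ [-]) ∷ [] , swap _ _ ↭-refl
    edgeCover Fin.zero           Fin.zero           ii = ⊥-elim (Adj-irrefl ii)
    edgeCover (Fin.suc Fin.zero) (Fin.suc Fin.zero) ii = ⊥-elim (Adj-irrefl ii)
  Hamiltonian⇒pathCover≤1 (inj₂ (inj₂ (_ , x , xs , x∷xs↭ , l , _))) =
    (x ∷ xs) ∷ [] , (l ∷ [] , subst (_↭ allFin N) (sym (List.++-identityʳ (x ∷ xs))) x∷xs↭) , ℕ.≤-refl

allFin-suc : ∀ k → allFin (suc k) ≡ Fin.zero ∷ map Fin.suc (allFin k)
allFin-suc k = cong (Fin.zero ∷_) (sym (List.map-tabulate id Fin.suc))

allFin-+ : ∀ m n → allFin (m + n) ≡ map (_↑ˡ n) (allFin m) ++ map (m ↑ʳ_) (allFin n)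
allFin-+ zero    n = sym (List.map-id (allFin n))
allFin-+ (suc m) n = begin
  allFin (suc m + n)
    ≡⟨ allFin-suc (m + n) ⟩
  Fin.zero ∷ map Fin.suc (allFin (m + n))
    ≡⟨ cong (λ t → Fin.zero ∷ map Fin.suc t) (allFin-+ m n) ⟩
  Fin.zero ∷ map Fin.suc (map (_↑ˡ n) (allFin m) ++ map (m ↑ʳ_) (allFin n))
    ≡⟨ cong (Fin.zero ∷_) (List.map-++ Fin.suc (map (_↑ˡ n) (allFin m)) _) ⟩
  Fin.zero ∷ (map Fin.suc (map (_↑ˡ n) (allFin m)) ++ map Fin.suc (map (m ↑ʳ_) (allFin n)))
    ≡⟨ cong₂ (λ s t → Fin.zero ∷ (s ++ t))
         (≡.trans (sym (List.map-∘ (allFin m))) (List.map-∘ (allFin m))) (sym (List.map-∘ (allFin n))) ⟩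
  Fin.zero ∷ (map (_↑ˡ n) (map Fin.suc (allFin m)) ++ map (suc m ↑ʳ_) (allFin n))
    ≡⟨ cong (λ t → map (_↑ˡ n) t ++ map (suc m ↑ʳ_) (allFin n)) (sym (allFin-suc m)) ⟩
  map (_↑ˡ n) (allFin (suc m)) ++ map (suc m ↑ʳ_) (allFin n)      ∎
  where open ≡-Reasoning

module _ {A B : Set} where

  lefts : List (A ⊎ B) → List A
  lefts = mapMaybe isInj₁

  rights : List (A ⊎ B) → List B
  rights = mapMaybe isInj₂

  lefts-inj₁++inj₂ : ∀ as bs → lefts (map inj₁ as ++ map inj₂ bs) ≡ as
  lefts-inj₁++inj₂ as bs = begin
    lefts (map inj₁ as ++ map inj₂ bs)          ≡⟨ List.mapMaybe-++ isInj₁ (map inj₁ as) _ ⟩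
    lefts (map inj₁ as) ++ lefts (map inj₂ bs)
      ≡⟨ cong₂ _++_ (List.mapMaybeIsInj₁∘mapInj₁ as) (List.mapMaybeIsInj₁∘mapInj₂ bs) ⟩
    as ++ []                                    ≡⟨ List.++-identityʳ as ⟩
    as                                          ∎
    where open ≡-Reasoning

  rights-inj₁++inj₂ : ∀ as bs → rights (map inj₁ as ++ map inj₂ bs) ≡ bs
  rights-inj₁++inj₂ as bs = begin
    rights (map inj₁ as ++ map inj₂ bs)           ≡⟨ List.mapMaybe-++ isInj₂ (map inj₁ as) _ ⟩
    rights (map inj₁ as) ++ rights (map inj₂ bs)
      ≡⟨ cong₂ _++_ (List.mapMaybeIsInj₂∘mapInj₁ as) (List.mapMaybeIsInj₂∘mapInj₂ bs) ⟩
    bs                                            ∎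
    where open ≡-Reasoning

-- unionWith G H c, read on Fin m ⊎ Fin n instead of Fin (m + n).
module Union {m n : ℕ} (G : Graph m) (H : Graph n) (c : Fin m → Fin n → Bool) where

  Vertex : Set
  Vertex = Fin m ⊎ Fin n

  adj⊎ : Vertex → Vertex → Bool
  adj⊎ (inj₁ i) (inj₁ j) = adj G i j
  adj⊎ (inj₂ i) (inj₂ j) = adj H i j
  adj⊎ (inj₁ i) (inj₂ j) = c i j
  adj⊎ (inj₂ j) (inj₁ i) = c i j

  Adj⊎ : Vertex → Vertex → Set
  Adj⊎ s t = adj⊎ s t ≡ true

  UG : Graph (m + n)
  UG = unionWith G H c

  toSum : Fin (m + n) → Vertex
  toSum = splitAt m

  fromSum : Vertex → Fin (m + n)
  fromSum = join m n

  toSum-injective : ∀ {a b} → toSum a ≡ toSum b → a ≡ b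
  toSum-injective {a} {b} eq = ≡.trans (sym (join-splitAt m n a)) (≡.trans (cong fromSum eq) (join-splitAt m n b))

  adj-toSum : ∀ x y → adj UG x y ≡ adj⊎ (toSum x) (toSum y)
  adj-toSum x y with splitAt m x | splitAt m y
  ... | inj₁ _ | inj₁ _ = refl
  ... | inj₁ _ | inj₂ _ = refl
  ... | inj₂ _ | inj₁ _ = refl
  ... | inj₂ _ | inj₂ _ = refl

  Adj-toSum : ∀ {x y} → Adj UG x y → Adj⊎ (toSum x) (toSum y)
  Adj-toSum {x} {y} xy = ≡.trans (sym (adj-toSum x y)) xy

  Adj-fromSum : ∀ {s t} → Adj⊎ s t → Adj UG (fromSum s) (fromSum t)
  Adj-fromSum {s} {t} st = ≡.trans (adj-toSum (fromSum s) (fromSum t))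
    (subst₂ (λ a b → adj⊎ a b ≡ true) (sym (splitAt-join m n s)) (sym (splitAt-join m n t)) st)

  Linked-toSum : ∀ {xs} → Linked (Adj UG) xs → Linked Adj⊎ (map toSum xs)
  Linked-toSum = Linked-map toSum Adj-toSum

  Linked-fromSum : ∀ {ss} → Linked Adj⊎ ss → Linked (Adj UG) (map fromSum ss)
  Linked-fromSum = Linked-map fromSum (λ {s} {t} → Adj-fromSum {s} {t})

  Linked-inj₂ : ∀ {bs} → Linked (Adj H) bs → Linked Adj⊎ (map inj₂ bs)
  Linked-inj₂ = Linked-map inj₂ id

  allVertices : List Vertex
  allVertices = map inj₁ (allFin m) ++ map inj₂ (allFin n)

  map-toSum-allFin : map toSum (allFin (m + n)) ≡ allVertices
  map-toSum-allFin = begin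
    map toSum (allFin (m + n))                                        ≡⟨ cong (map toSum) (allFin-+ m n) ⟩
    map toSum (map (_↑ˡ n) (allFin m) ++ map (m ↑ʳ_) (allFin n))
      ≡⟨ List.map-++ toSum (map (_↑ˡ n) (allFin m)) _ ⟩
    map toSum (map (_↑ˡ n) (allFin m)) ++ map toSum (map (m ↑ʳ_) (allFin n))
      ≡⟨ cong₂ _++_ (sym (List.map-∘ (allFin m))) (sym (List.map-∘ (allFin n))) ⟩
    map (toSum ∘ (_↑ˡ n)) (allFin m) ++ map (toSum ∘ (m ↑ʳ_)) (allFin n)
      ≡⟨ cong₂ _++_ (List.map-cong (λ i → splitAt-↑ˡ m i n) (allFin m))
                    (List.map-cong (splitAt-↑ʳ m n) (allFin n)) ⟩
    allVertices                                                       ∎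
    where open ≡-Reasoning

  map-fromSum-allVertices : map fromSum allVertices ≡ allFin (m + n)
  map-fromSum-allVertices = begin
    map fromSum allVertices
      ≡⟨ List.map-++ fromSum (map inj₁ (allFin m)) _ ⟩
    map fromSum (map inj₁ (allFin m)) ++ map fromSum (map inj₂ (allFin n))
      ≡⟨ cong₂ _++_ (sym (List.map-∘ (allFin m))) (sym (List.map-∘ (allFin n))) ⟩
    map (_↑ˡ n) (allFin m) ++ map (m ↑ʳ_) (allFin n)                      ≡⟨ allFin-+ m n ⟨
    allFin (m + n)                                                       ∎
    where open ≡-Reasoning

  ↭-toSum : ∀ {xs} → xs ↭ allFin (m + n) → map toSum xs ↭ allVertices
  ↭-toSum p = subst (map toSum _ ↭_) map-toSum-allFin (map⁺ toSum p)

  ↭-fromSum : ∀ {ss} → ss ↭ allVertices → map fromSum ss ↭ allFin (m + n)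
  ↭-fromSum p = subst (map fromSum _ ↭_) map-fromSum-allVertices (map⁺ fromSum p)

  lefts-↭ : ∀ {ss} → ss ↭ allVertices → lefts ss ↭ allFin m
  lefts-↭ {ss} p = subst (lefts ss ↭_) (lefts-inj₁++inj₂ (allFin m) (allFin n)) (mapMaybe-↭ isInj₁ p)

  rights-↭ : ∀ {ss} → ss ↭ allVertices → rights ss ↭ allFin n
  rights-↭ {ss} p = subst (rights ss ↭_) (rights-inj₁++inj₂ (allFin m) (allFin n)) (mapMaybe-↭ isInj₂ p)

module JoinComplete {N : ℕ} (X : Graph N) (k : ℕ) where
  open Union (complete (suc k)) X (λ _ _ → true) public

  interleave : List (Fin (suc k)) → List (List (Fin N)) → List Vertex
  interleave (i ∷ is) (p ∷ ps) = inj₁ i ∷ map inj₂ p ++ interleave is ps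
  interleave _        _        = []

  interleave-↭ : ∀ is ps → length is ≡ length ps →
                 interleave is ps ↭ map inj₁ is ++ map inj₂ (concat ps)
  interleave-↭ []       []       _  = ↭-refl
  interleave-↭ (i ∷ is) (p ∷ ps) eq = prep (inj₁ i) (begin
    map inj₂ p ++ interleave is ps
      ↭⟨ ++⁺ˡ (map inj₂ p) (interleave-↭ is ps (ℕ.suc-injective eq)) ⟩
    map inj₂ p ++ map inj₁ is ++ map inj₂ (concat ps)
      ↭⟨ shifts (map inj₂ p) (map inj₁ is) ⟩
    map inj₁ is ++ map inj₂ p ++ map inj₂ (concat ps)
      ≡⟨ cong (map inj₁ is ++_) (List.map-++ inj₂ p (concat ps)) ⟨
    map inj₁ is ++ map inj₂ (p ++ concat ps) ∎)
    where open PermutationReasoning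

  Linked-lastSegment : ∀ i b p → Linked (Adj X) (b ∷ p) →
                       Linked Adj⊎ (inj₁ i ∷ map inj₂ (b ∷ p) ++ []) ×
                       ∃ λ b′ → lastOf (inj₁ i) (map inj₂ (b ∷ p) ++ []) ≡ inj₂ b′
  Linked-lastSegment i b p l =
    subst (λ t → Linked Adj⊎ (inj₁ i ∷ t) × ∃ λ b′ → lastOf (inj₁ i) t ≡ inj₂ b′)
      (sym (List.++-identityʳ (map inj₂ (b ∷ p))))
      (refl ∷ Linked-inj₂ l , lastOf b p , lastOf-map inj₂ b p)

  Linked-interleave : ∀ i is p ps → All (IsPath X) (p ∷ ps) →
                      Linked Adj⊎ (inj₁ i ∷ map inj₂ p ++ interleave is ps) ×
                      ∃ λ b → lastOf (inj₁ i) (map inj₂ p ++ interleave is ps) ≡ inj₂ b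
  Linked-interleave i []        (b ∷ p) ps        (l ∷ _)  = Linked-lastSegment i b p l
  Linked-interleave i (_ ∷ _)   (b ∷ p) []        (l ∷ _)  = Linked-lastSegment i b p l
  Linked-interleave i (i′ ∷ is) (b ∷ p) (p′ ∷ ps) (l ∷ ls) with Linked-interleave i′ is p′ ps ls
  ... | l′ , b′ , last≡b′ =
    Linked-++⁺ (refl ∷ Linked-inj₂ l) (subst (λ t → Adj⊎ t (inj₁ i′)) (sym (lastOf-map inj₂ b p)) refl) l′ ,
    b′ , ≡.trans (lastOf-++ (inj₁ i) (map inj₂ (b ∷ p)) _) last≡b′

  Hamiltonian-interleave : ∀ {p ps} → IsPathCover X (p ∷ ps) → length ps ≡ k →
                           Hamiltonian (complete (suc k) ∗ X)
  Hamiltonian-interleave {[]}    {ps} (() ∷ _ , _)     _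
  Hamiltonian-interleave {b ∷ p} {ps} (paths , concat↭) len≡k with 3 ℕ.≤? suc k + N
  ... | yes 3≤size =
    inj₂ (inj₂ (3≤size , fromSum (inj₁ Fin.zero) , map fromSum cycle , vertices , edges , closing))
    where
    cycle = map inj₂ (b ∷ p) ++ interleave (tabulate Fin.suc) ps
    linked = Linked-interleave Fin.zero (tabulate Fin.suc) (b ∷ p) ps paths
    vertices : fromSum (inj₁ Fin.zero) ∷ map fromSum cycle ↭ allFin (suc k + N)
    vertices = ↭-fromSum (↭-trans (interleave-↭ (allFin (suc k)) ((b ∷ p) ∷ ps) lengths)
                                  (++⁺ˡ (map inj₁ (allFin (suc k))) (map⁺ inj₂ concat↭)))
      where lengths = cong suc (≡.trans (List.length-tabulate Fin.suc) (sym len≡k))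
    edges = Linked-fromSum (proj₁ linked)
    closing : Adj UG (lastOf (fromSum (inj₁ Fin.zero)) (map fromSum cycle)) (fromSum (inj₁ Fin.zero))
    closing with proj₂ linked
    ... | b′ , last≡b′ rewrite lastOf-map fromSum (inj₁ Fin.zero) cycle | last≡b′ =
      Adj-fromSum {inj₂ b′} {inj₁ Fin.zero} refl
  ... | no 3≰size =
    inj₂ (inj₁ (size≡2 , fromSum (inj₁ Fin.zero) , fromSum (inj₂ b) , Adj-fromSum {inj₁ Fin.zero} {inj₂ b} refl))
    where
    size≡2 : suc k + N ≡ 2
    size≡2 = ℕ.≤-antisym (ℕ.≤-pred (ℕ.≰⇒> 3≰size)) (s≤s (ℕ.≤-trans (1≤size b) (ℕ.m≤n+m N k)))

  consNonEmpty : List (Fin N) → List (List (Fin N)) → List (List (Fin N))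
  consNonEmpty []      rs = rs
  consNonEmpty (b ∷ r) rs = (b ∷ r) ∷ rs

  -- The run of vertices of X before the first vertex of K_(k+1), and the nonempty runs after it.
  blocks : List Vertex → List (Fin N) × List (List (Fin N))
  blocks []            = [] , []
  blocks (inj₂ b ∷ ss) = b ∷ proj₁ (blocks ss) , proj₂ (blocks ss)
  blocks (inj₁ _ ∷ ss) = [] , consNonEmpty (proj₁ (blocks ss)) (proj₂ (blocks ss))

  concat-blocks : ∀ ss → proj₁ (blocks ss) ++ concat (proj₂ (blocks ss)) ≡ rights ss
  concat-blocks []            = refl
  concat-blocks (inj₂ b ∷ ss) = cong (b ∷_) (concat-blocks ss)
  concat-blocks (inj₁ _ ∷ ss) with proj₁ (blocks ss) | concat-blocks ss
  ... | []    | eq = eq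
  ... | _ ∷ _ | eq = eq

  length-blocks : ∀ ss → length (proj₂ (blocks ss)) ≤ length (lefts ss)
  length-blocks []            = z≤n
  length-blocks (inj₂ _ ∷ ss) = length-blocks ss
  length-blocks (inj₁ _ ∷ ss) with proj₁ (blocks ss)
  ... | []    = ℕ.m≤n⇒m≤1+n (length-blocks ss)
  ... | _ ∷ _ = s≤s (length-blocks ss)

  blocks-paths : ∀ ss → Linked Adj⊎ ss → Linked (Adj X) (proj₁ (blocks ss)) × All (IsPath X) (proj₂ (blocks ss))
  blocks-paths []                          _       = [] , []
  blocks-paths (inj₂ b ∷ [])               _       = [-] , []
  blocks-paths (inj₂ b ∷ inj₂ b′ ∷ ss)     (e ∷ l) = Prod.map₁ (e ∷_) (blocks-paths (inj₂ b′ ∷ ss) l)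
  blocks-paths (inj₂ b ∷ inj₁ a ∷ ss)      (_ ∷ l) = [-] , proj₂ (blocks-paths (inj₁ a ∷ ss) l)
  blocks-paths (inj₁ _ ∷ ss)               l       with proj₁ (blocks ss) | blocks-paths ss (Linked.tail l)
  ... | []    | _ , ps = [] , ps
  ... | _ ∷ _ | l′ , ps = [] , l′ ∷ ps

  pathCover-from-cycle : ∀ a ss → Linked Adj⊎ (inj₁ a ∷ ss) → inj₁ a ∷ ss ↭ allVertices →
                         ∃ λ qs → IsPathCover X qs × length qs ≤ suc k
  pathCover-from-cycle a ss l p =
    proj₂ (blocks (inj₁ a ∷ ss)) ,
    (proj₂ (blocks-paths (inj₁ a ∷ ss) l) , subst (_↭ allFin N) (sym (concat-blocks (inj₁ a ∷ ss))) (rights-↭ p)) ,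
    ℕ.≤-trans (length-blocks (inj₁ a ∷ ss))
      (ℕ.≤-reflexive (≡.trans (↭-length (lefts-↭ p)) (List.length-tabulate id)))

  pathCover-of-Hamiltonian : Hamiltonian (complete (suc k) ∗ X) → ∃ λ qs → IsPathCover X qs × length qs ≤ suc k
  pathCover-of-Hamiltonian (inj₁ size≡1) with pathCover≤1 X (subst (N ≤_) size≡1 (ℕ.m≤n+m N (suc k)))
  ... | qs , cover , len≤1 = qs , cover , ℕ.≤-trans len≤1 (s≤s z≤n)
  pathCover-of-Hamiltonian (inj₂ (inj₁ (size≡2 , _)))
    with pathCover≤1 X (subst (N ≤_) (ℕ.suc-injective size≡2) (ℕ.m≤n+m N k))
  ... | qs , cover , len≤1 = qs , cover , ℕ.≤-trans len≤1 (s≤s z≤n)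
  -- Rotate the cycle to start at Fin.zero, which splitAt sends to the first vertex of K_(k+1).
  pathCover-of-Hamiltonian (inj₂ (inj₂ (_ , x , xs , x∷xs↭ , l , closing)))
    with ∈-∃++ (∈-resp-↭ (↭-sym x∷xs↭) (∈-allFin Fin.zero))
  ... | as , bs , x∷xs≡ with rotateCycle x xs l closing as Fin.zero bs x∷xs≡
  ...   | ys , l′ , ys↭ =
    pathCover-from-cycle Fin.zero (map toSum ys) (Linked-toSum l′) (↭-toSum (↭-trans ys↭ x∷xs↭))

isMuCheck-minPathCover : ∀ {N} (X : Graph N) {ps} → IsMinPathCover X ps → Fin N →
                         ¬ Hamiltonian (complete 0 ∗ X) → IsMuCheck X (length ps)
isMuCheck-minPathCover X {[]}     (cover , _)       i _ = ⊥-elim (ℕ.<-irrefl refl (pathCover-nonempty cover i))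
isMuCheck-minPathCover X {p ∷ ps} (cover , minimal) _ nonHamiltonian =
  JoinComplete.Hamiltonian-interleave X (length ps) cover refl , smaller
  where
  smaller : ∀ l → l < suc (length ps) → ¬ Hamiltonian (complete l ∗ X)
  smaller zero    _   = nonHamiltonian
  smaller (suc k) k<μ ham with JoinComplete.pathCover-of-Hamiltonian X k ham
  ... | qs , cover′ , len≤ = ℕ.<⇒≱ k<μ (ℕ.≤-trans (minimal qs cover′) len≤)

module Bridge {m n : ℕ} (G : Graph m) (H : Graph n) (c : Fin m → Fin n → Bool) (v : Fin m) (w : Fin n)
              (cross⇒vw : ∀ a b → c a b ≡ true → a ≡ v × b ≡ w) where
  open Union G H c public

  data Shape : List Vertex → Set where
    inG : ∀ {a A} → Linked (Adj G) (a ∷ A) → Shape (map inj₁ (a ∷ A))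
    inH : ∀ {b B} → Linked (Adj H) (b ∷ B) → Shape (map inj₂ (b ∷ B))
    G→H : ∀ {a A b B} → Linked (Adj G) (a ∷ A) → Linked (Adj H) (b ∷ B) → lastOf a A ≡ v → b ≡ w →
          c v w ≡ true → Shape (map inj₁ (a ∷ A) ++ map inj₂ (b ∷ B))
    H→G : ∀ {b B a A} → Linked (Adj H) (b ∷ B) → Linked (Adj G) (a ∷ A) → lastOf b B ≡ w → a ≡ v →
          c v w ≡ true → Shape (map inj₂ (b ∷ B) ++ map inj₁ (a ∷ A))

  crossing⇒cvw : ∀ {a b} → c a b ≡ true → c v w ≡ true
  crossing⇒cvw {a} {b} ab with cross⇒vw a b ab
  ... | refl , refl = ab

  shape : ∀ s ss → Linked Adj⊎ (s ∷ ss) → Unique (s ∷ ss) → Shape (s ∷ ss)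
  shape (inj₁ a) [] _ _ = inG [-]
  shape (inj₂ b) [] _ _ = inH [-]
  shape (inj₁ a) (t ∷ ss) (e ∷ l) (_ ∷ u) with shape t ss l u
  ... | inG l′ = inG (e ∷ l′)
  ... | inH {b} l′ with cross⇒vw a b e
  ...   | a≡v , b≡w = G→H [-] l′ a≡v b≡w (crossing⇒cvw e)
  shape (inj₁ a) (t ∷ ss) (e ∷ l) (_ ∷ u) | G→H l₁ l₂ last≡v b≡w cvw = G→H (e ∷ l₁) l₂ last≡v b≡w cvw
  shape (inj₁ a) (t ∷ ss) (e ∷ l) (a∉ ∷ u) | H→G {b} {B} l₁ l₂ _ a′≡v _ =
    ⊥-elim (All.lookup a∉ (∈-++⁺ʳ (map inj₂ (b ∷ B)) (here (cong inj₁ a≡a′))) refl)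
    where a≡a′ = ≡.trans (proj₁ (cross⇒vw a b e)) (sym a′≡v)
  shape (inj₂ b) (t ∷ ss) (e ∷ l) (_ ∷ u) with shape t ss l u
  ... | inH l′ = inH (e ∷ l′)
  ... | inG {a} l′ with cross⇒vw a b e
  ...   | a≡v , b≡w = H→G [-] l′ b≡w a≡v (crossing⇒cvw e)
  shape (inj₂ b) (t ∷ ss) (e ∷ l) (_ ∷ u) | H→G l₁ l₂ last≡w a≡v cvw = H→G (e ∷ l₁) l₂ last≡w a≡v cvw
  shape (inj₂ b) (t ∷ ss) (e ∷ l) (b∉ ∷ u) | G→H {a} {A} l₁ l₂ _ b′≡w _ =
    ⊥-elim (All.lookup b∉ (∈-++⁺ʳ (map inj₁ (a ∷ A)) (here (cong inj₂ b≡b′))) refl)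
    where b≡b′ = ≡.trans (proj₂ (cross⇒vw a b e)) (sym b′≡w)

  leftPaths : ∀ {ss} → Shape ss → List (List (Fin m))
  leftPaths (inG {a} {A} _)         = (a ∷ A) ∷ []
  leftPaths (inH _)                 = []
  leftPaths (G→H {a} {A} _ _ _ _ _) = (a ∷ A) ∷ []
  leftPaths (H→G {a = a} {A} _ _ _ _ _) = (a ∷ A) ∷ []

  rightPaths : ∀ {ss} → Shape ss → List (List (Fin n))
  rightPaths (inG _)                     = []
  rightPaths (inH {b} {B} _)             = (b ∷ B) ∷ []
  rightPaths (G→H {b = b} {B} _ _ _ _ _) = (b ∷ B) ∷ []
  rightPaths (H→G {b} {B} _ _ _ _ _)     = (b ∷ B) ∷ []

  crossings : ∀ {ss} → Shape ss → ℕ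
  crossings (inG _)           = 0
  crossings (inH _)           = 0
  crossings (G→H _ _ _ _ _)   = 1
  crossings (H→G _ _ _ _ _)   = 1

  lefts-shape : ∀ {ss} (σ : Shape ss) → lefts ss ≡ concat (leftPaths σ)
  lefts-shape (inG {a} {A} _) =
    ≡.trans (List.mapMaybeIsInj₁∘mapInj₁ (a ∷ A)) (sym (List.++-identityʳ (a ∷ A)))
  lefts-shape (inH {b} {B} _) = List.mapMaybeIsInj₁∘mapInj₂ (b ∷ B)
  lefts-shape (G→H {a} {A} {b} {B} _ _ _ _ _) =
    ≡.trans (lefts-inj₁++inj₂ (a ∷ A) (b ∷ B)) (sym (List.++-identityʳ (a ∷ A)))
  lefts-shape (H→G {b} {B} {a} {A} _ _ _ _ _) = begin
    lefts (map inj₂ (b ∷ B) ++ map inj₁ (a ∷ A))          ≡⟨ List.mapMaybe-++ isInj₁ (map inj₂ (b ∷ B)) _ ⟩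
    lefts (map inj₂ (b ∷ B)) ++ lefts (map inj₁ (a ∷ A))
      ≡⟨ cong₂ _++_ (List.mapMaybeIsInj₁∘mapInj₂ (b ∷ B)) (List.mapMaybeIsInj₁∘mapInj₁ (a ∷ A)) ⟩
    a ∷ A                                                 ≡⟨ List.++-identityʳ (a ∷ A) ⟨
    (a ∷ A) ++ []                                         ∎
    where open ≡-Reasoning

  rights-shape : ∀ {ss} (σ : Shape ss) → rights ss ≡ concat (rightPaths σ)
  rights-shape (inG {a} {A} _) = List.mapMaybeIsInj₂∘mapInj₁ (a ∷ A)
  rights-shape (inH {b} {B} _) =
    ≡.trans (List.mapMaybeIsInj₂∘mapInj₂ (b ∷ B)) (sym (List.++-identityʳ (b ∷ B)))
  rights-shape (G→H {a} {A} {b} {B} _ _ _ _ _) =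
    ≡.trans (rights-inj₁++inj₂ (a ∷ A) (b ∷ B)) (sym (List.++-identityʳ (b ∷ B)))
  rights-shape (H→G {b} {B} {a} {A} _ _ _ _ _) = begin
    rights (map inj₂ (b ∷ B) ++ map inj₁ (a ∷ A))           ≡⟨ List.mapMaybe-++ isInj₂ (map inj₂ (b ∷ B)) _ ⟩
    rights (map inj₂ (b ∷ B)) ++ rights (map inj₁ (a ∷ A))
      ≡⟨ cong₂ _++_ (List.mapMaybeIsInj₂∘mapInj₂ (b ∷ B)) (List.mapMaybeIsInj₂∘mapInj₁ (a ∷ A)) ⟩
    (b ∷ B) ++ []                                           ∎
    where open ≡-Reasoning

  leftPaths-paths : ∀ {ss} (σ : Shape ss) → All (IsPath G) (leftPaths σ)
  leftPaths-paths (inG l)             = l ∷ []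
  leftPaths-paths (inH _)             = []
  leftPaths-paths (G→H l _ _ _ _)     = l ∷ []
  leftPaths-paths (H→G _ l _ _ _)     = l ∷ []

  rightPaths-paths : ∀ {ss} (σ : Shape ss) → All (IsPath H) (rightPaths σ)
  rightPaths-paths (inG _)            = []
  rightPaths-paths (inH l)            = l ∷ []
  rightPaths-paths (G→H _ l _ _ _)    = l ∷ []
  rightPaths-paths (H→G l _ _ _ _)    = l ∷ []

  length-shapePaths : ∀ {ss} (σ : Shape ss) → length (leftPaths σ) + length (rightPaths σ) ≡ suc (crossings σ)
  length-shapePaths (inG _)           = refl
  length-shapePaths (inH _)           = refl
  length-shapePaths (G→H _ _ _ _ _)   = refl
  length-shapePaths (H→G _ _ _ _ _)   = refl

  crossing⇒terminals : ∀ {ss} (σ : Shape ss) → 1 ≤ crossings σ →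
                       Any (IsTerminal v) (leftPaths σ) × Any (IsTerminal w) (rightPaths σ)
  crossing⇒terminals (G→H _ _ last≡v b≡w _) _ = here (inj₂ (sym last≡v)) , here (inj₁ (sym b≡w))
  crossing⇒terminals (H→G _ _ last≡w a≡v _) _ = here (inj₁ (sym a≡v)) , here (inj₂ (sym last≡w))

  crossing⇒v∈ : ∀ {ss} (σ : Shape ss) → 1 ≤ crossings σ → inj₁ v ∈ ss
  crossing⇒v∈ (G→H {a} {A} _ _ last≡v _ _) _ =
    ∈-++⁺ˡ (subst (λ t → inj₁ t ∈ map inj₁ (a ∷ A)) last≡v (∈-map⁺ inj₁ (lastOf-∈ a A)))
  crossing⇒v∈ (H→G {b} {B} _ _ _ a≡v _) _ = ∈-++⁺ʳ (map inj₂ (b ∷ B)) (here (cong inj₁ (sym a≡v)))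

  no-crossings : c v w ≡ false → ∀ {ss} (σ : Shape ss) → crossings σ ≡ 0
  no-crossings _      (inG _)            = refl
  no-crossings _      (inH _)            = refl
  no-crossings cvw≢ (G→H _ _ _ _ cvw) with ≡.trans (sym cvw≢) cvw
  ... | ()
  no-crossings cvw≢ (H→G _ _ _ _ cvw) with ≡.trans (sym cvw≢) cvw
  ... | ()

  crossings≤1 : ∀ {ss} (σ : Shape ss) → crossings σ ≤ 1
  crossings≤1 (inG _)         = z≤n
  crossings≤1 (inH _)         = z≤n
  crossings≤1 (G→H _ _ _ _ _) = ℕ.≤-refl
  crossings≤1 (H→G _ _ _ _ _) = ℕ.≤-refl

  leftCover : ∀ {qss} → All Shape qss → List (List (Fin m))
  leftCover []       = []
  leftCover (σ ∷ σs) = leftPaths σ ++ leftCover σs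

  rightCover : ∀ {qss} → All Shape qss → List (List (Fin n))
  rightCover []       = []
  rightCover (σ ∷ σs) = rightPaths σ ++ rightCover σs

  totalCrossings : ∀ {qss} → All Shape qss → ℕ
  totalCrossings []       = 0
  totalCrossings (σ ∷ σs) = crossings σ + totalCrossings σs

  lefts-concat : ∀ {qss} (σs : All Shape qss) → lefts (concat qss) ≡ concat (leftCover σs)
  lefts-concat []                  = refl
  lefts-concat {ss ∷ qss} (σ ∷ σs) = begin
    lefts (ss ++ concat qss)                         ≡⟨ List.mapMaybe-++ isInj₁ ss (concat qss) ⟩
    lefts ss ++ lefts (concat qss)                   ≡⟨ cong₂ _++_ (lefts-shape σ) (lefts-concat σs) ⟩
    concat (leftPaths σ) ++ concat (leftCover σs)    ≡⟨ List.concat-++ (leftPaths σ) (leftCover σs) ⟩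
    concat (leftPaths σ ++ leftCover σs)             ∎
    where open ≡-Reasoning

  rights-concat : ∀ {qss} (σs : All Shape qss) → rights (concat qss) ≡ concat (rightCover σs)
  rights-concat []                  = refl
  rights-concat {ss ∷ qss} (σ ∷ σs) = begin
    rights (ss ++ concat qss)                        ≡⟨ List.mapMaybe-++ isInj₂ ss (concat qss) ⟩
    rights ss ++ rights (concat qss)                  ≡⟨ cong₂ _++_ (rights-shape σ) (rights-concat σs) ⟩
    concat (rightPaths σ) ++ concat (rightCover σs)  ≡⟨ List.concat-++ (rightPaths σ) (rightCover σs) ⟩
    concat (rightPaths σ ++ rightCover σs)           ∎
    where open ≡-Reasoning

  leftCover-paths : ∀ {qss} (σs : All Shape qss) → All (IsPath G) (leftCover σs)
  leftCover-paths []       = []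
  leftCover-paths (σ ∷ σs) = Allₚ.++⁺ (leftPaths-paths σ) (leftCover-paths σs)

  rightCover-paths : ∀ {qss} (σs : All Shape qss) → All (IsPath H) (rightCover σs)
  rightCover-paths []       = []
  rightCover-paths (σ ∷ σs) = Allₚ.++⁺ (rightPaths-paths σ) (rightCover-paths σs)

  length-covers : ∀ {qss} (σs : All Shape qss) →
                  length (leftCover σs) + length (rightCover σs) ≡ length qss + totalCrossings σs
  length-covers []                  = refl
  length-covers {_ ∷ qss} (σ ∷ σs) = begin
    length (leftPaths σ ++ leftCover σs) + length (rightPaths σ ++ rightCover σs)
      ≡⟨ cong₂ _+_ (List.length-++ (leftPaths σ)) (List.length-++ (rightPaths σ)) ⟩
    (length (leftPaths σ) + length (leftCover σs)) + (length (rightPaths σ) + length (rightCover σs))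
      ≡⟨ ℕ+.interchange (length (leftPaths σ)) (length (leftCover σs))
                        (length (rightPaths σ)) (length (rightCover σs)) ⟩
    (length (leftPaths σ) + length (rightPaths σ)) + (length (leftCover σs) + length (rightCover σs))
      ≡⟨ cong₂ _+_ (length-shapePaths σ) (length-covers σs) ⟩
    suc (crossings σ + (length qss + totalCrossings σs))
      ≡⟨ cong suc (ℕ+.x∙yz≈y∙xz (crossings σ) (length qss) (totalCrossings σs)) ⟩
    suc (length qss + (crossings σ + totalCrossings σs)) ∎
    where open ≡-Reasoning

  crossings⇒terminals : ∀ {qss} (σs : All Shape qss) → 1 ≤ totalCrossings σs →
                        Any (IsTerminal v) (leftCover σs) × Any (IsTerminal w) (rightCover σs)
  crossings⇒terminals (σ ∷ σs) some with crossings σ | crossing⇒terminals σ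
  ... | zero  | _         =
    Prod.map (Any.++⁺ʳ (leftPaths σ)) (Any.++⁺ʳ (rightPaths σ)) (crossings⇒terminals σs some)
  ... | suc _ | terminals = Prod.map Any.++⁺ˡ Any.++⁺ˡ (terminals (s≤s z≤n))

  crossings⇒v∈ : ∀ {qss} (σs : All Shape qss) → 1 ≤ totalCrossings σs → inj₁ v ∈ concat qss
  crossings⇒v∈ {ss ∷ _} (σ ∷ σs) some with crossings σ | crossing⇒v∈ σ
  ... | zero  | _    = ∈-++⁺ʳ ss (crossings⇒v∈ σs some)
  ... | suc _ | v∈ss = ∈-++⁺ˡ (v∈ss (s≤s z≤n))

  -- Two crossing paths would both contain v.
  totalCrossings≤1 : ∀ {qss} (σs : All Shape qss) → Unique (concat qss) → totalCrossings σs ≤ 1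
  totalCrossings≤1 []                _ = z≤n
  totalCrossings≤1 {ss ∷ _} (σ ∷ σs) u with crossings σ | crossings≤1 σ | crossing⇒v∈ σ
  ... | zero     | _      | _    = totalCrossings≤1 σs (Unique-++⁻ʳ ss u)
  ... | suc zero | _      | v∈ss =
    s≤s (ℕ.≤-pred (ℕ.≰⇒> λ some → Unique-++⇒disjoint ss u (v∈ss (s≤s z≤n)) (crossings⇒v∈ σs some)))
  ... | suc (suc _) | s≤s () | _

  no-totalCrossings : c v w ≡ false → ∀ {qss} (σs : All Shape qss) → totalCrossings σs ≡ 0
  no-totalCrossings _      []       = refl
  no-totalCrossings cvw≢ (σ ∷ σs) = cong₂ _+_ (no-crossings cvw≢ σ) (no-totalCrossings cvw≢ σs)

  shapes : ∀ qs → All (IsPath UG) qs → Unique (concat qs) → All Shape (map (map toSum) qs)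
  shapes []              _        _ = []
  shapes ((x ∷ xs) ∷ qs) (l ∷ ls) u =
    shape (toSum x) (map toSum xs) (Linked-toSum l) (Unique.map⁺ toSum-injective (Unique-++⁻ˡ (x ∷ xs) u))
      ∷ shapes qs ls (Unique-++⁻ʳ (x ∷ xs) u)

  record SplitCover (qs : List (List (Fin (m + n)))) : Set where
    field
      coverG            : List (List (Fin m))
      coverH            : List (List (Fin n))
      crossed           : ℕ
      isCoverG          : IsPathCover G coverG
      isCoverH          : IsPathCover H coverH
      length-split      : length coverG + length coverH ≡ length qs + crossed
      crossed≤1         : crossed ≤ 1
      crossed⇒terminals : 1 ≤ crossed → Any (IsTerminal v) coverG × Any (IsTerminal w) coverH
      uncrossed         : c v w ≡ false → crossed ≡ 0

    length-uncrossed : crossed ≡ 0 → length coverG + length coverH ≡ length qs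
    length-uncrossed crossed≡0 =
      ≡.trans length-split (≡.trans (cong (length qs +_) crossed≡0) (ℕ.+-identityʳ (length qs)))

    length-split≤ : length coverG + length coverH ≤ suc (length qs)
    length-split≤ = begin
      length coverG + length coverH ≡⟨ length-split ⟩
      length qs + crossed           ≤⟨ ℕ.+-monoʳ-≤ (length qs) crossed≤1 ⟩
      length qs + 1                 ≡⟨ ℕ.+-comm (length qs) 1 ⟩
      suc (length qs)               ∎
      where open ℕ.≤-Reasoning

  splitCover : ∀ {qs} → IsPathCover UG qs → SplitCover qs
  splitCover {qs} (paths , qs↭) = record
    { coverG            = leftCover σs
    ; coverH            = rightCover σs
    ; crossed           = totalCrossings σs
    ; isCoverG          = leftCover-paths σs , subst (_↭ allFin m) (lefts-concat σs) (lefts-↭ concat↭)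
    ; isCoverH          = rightCover-paths σs , subst (_↭ allFin n) (rights-concat σs) (rights-↭ concat↭)
    ; length-split      = ≡.trans (length-covers σs) (cong (_+ totalCrossings σs) (List.length-map (map toSum) qs))
    ; crossed≤1         = totalCrossings≤1 σs (subst Unique (sym concat-map) (Unique.map⁺ toSum-injective unique))
    ; crossed⇒terminals = crossings⇒terminals σs
    ; uncrossed         = λ cvw≢ → no-totalCrossings cvw≢ σs
    }
    where
    unique = Unique-resp-↭ (↭-sym qs↭) (Unique.allFin⁺ (m + n))
    σs = shapes qs paths unique
    concat-map : concat (map (map toSum) qs) ≡ map toSum (concat qs)
    concat-map = List.concat-map qs
    concat↭ : concat (map (map toSum) qs) ↭ allVertices
    concat↭ = subst (_↭ allVertices) (sym concat-map) (↭-toSum qs↭)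

  embed : List (List (Fin m)) → List (List (Fin n)) → List (List (Fin (m + n)))
  embed gs hs = map (map (_↑ˡ n)) gs ++ map (map (m ↑ʳ_)) hs

  length-embed : ∀ gs hs → length (embed gs hs) ≡ length gs + length hs
  length-embed gs hs =
    ≡.trans (List.length-++ (map (map (_↑ˡ n)) gs)) (cong₂ _+_ (List.length-map _ gs) (List.length-map _ hs))

  concat-embed : ∀ gs hs → concat (embed gs hs) ≡ map (_↑ˡ n) (concat gs) ++ map (m ↑ʳ_) (concat hs)
  concat-embed gs hs =
    ≡.trans (sym (List.concat-++ (map (map (_↑ˡ n)) gs) _)) (cong₂ _++_ (List.concat-map gs) (List.concat-map hs))

  Linked-↑ˡ : ∀ {as} → Linked (Adj G) as → Linked (Adj UG) (map (_↑ˡ n) as)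
  Linked-↑ˡ = Linked-map (_↑ˡ n) (λ {a} {b} → Adj-fromSum {inj₁ a} {inj₁ b})

  Linked-↑ʳ : ∀ {bs} → Linked (Adj H) bs → Linked (Adj UG) (map (m ↑ʳ_) bs)
  Linked-↑ʳ = Linked-map (m ↑ʳ_) (λ {a} {b} → Adj-fromSum {inj₂ a} {inj₂ b})

  embed-paths : ∀ {gs hs} → All (IsPath G) gs → All (IsPath H) hs → All (IsPath UG) (embed gs hs)
  embed-paths gps hps = Allₚ.++⁺ (Allₚ.map⁺ (All.map ↑ˡ-path gps)) (Allₚ.map⁺ (All.map ↑ʳ-path hps))
    where
    ↑ˡ-path : ∀ {p} → IsPath G p → IsPath UG (map (_↑ˡ n) p)
    ↑ˡ-path {_ ∷ _} = Linked-↑ˡ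
    ↑ʳ-path : ∀ {p} → IsPath H p → IsPath UG (map (m ↑ʳ_) p)
    ↑ʳ-path {_ ∷ _} = Linked-↑ʳ

  embedCover : ∀ {gs hs} → IsPathCover G gs → IsPathCover H hs → IsPathCover UG (embed gs hs)
  embedCover {gs} {hs} (gps , gs↭) (hps , hs↭) =
    embed-paths gps hps ,
    subst (_↭ allFin (m + n)) (sym (concat-embed gs hs))
      (↭-trans (++⁺ (map⁺ (_↑ˡ n) gs↭) (map⁺ (m ↑ʳ_) hs↭)) (↭-reflexive (sym (allFin-+ m n))))

  joinCover : c v w ≡ true → ∀ {gs hs} → IsPathCover G gs → Any (IsTerminal v) gs →
              IsPathCover H hs → Any (IsTerminal w) hs →
              ∃ λ qs → IsPathCover UG qs × suc (length qs) ≡ length gs + length hs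
  joinCover cvw {gs} {hs} gcover v∈gs hcover w∈hs with extract v∈gs | extract w∈hs
  ... | p , rg , v-end , gs↭ | q , rh , w-end , hs↭
    with All-resp-↭ gs↭ (proj₁ gcover) | All-resp-↭ hs↭ (proj₁ hcover)
  ... | p-path ∷ _ | q-path ∷ _ with pathEndingAt v p p-path v-end | pathStartingAt w q q-path w-end
  ... | a , A , la , aA↭p , last≡v | b , B , lb , bB↭q , b≡w =
    (map (_↑ˡ n) (a ∷ A) ++ map (m ↑ʳ_) (b ∷ B)) ∷ embed rg rh , pathCover-join separate bridge , lengths
    where
    separate : IsPathCover UG (map (_↑ˡ n) (a ∷ A) ∷ map (m ↑ʳ_) (b ∷ B) ∷ embed rg rh)
    separate = pathCover-↭
      (embedCover (pathCover-replace gcover gs↭ aA↭p la) (pathCover-replace hcover hs↭ bB↭q lb))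
      (prep _ (shift (map (m ↑ʳ_) (b ∷ B)) (map (map (_↑ˡ n)) rg) (map (map (m ↑ʳ_)) rh)))
    bridge : Adj UG (lastOf (a ↑ˡ n) (map (_↑ˡ n) A)) (m ↑ʳ b)
    bridge = subst₂ (Adj UG) (sym (≡.trans (lastOf-map (_↑ˡ n) a A) (cong (_↑ˡ n) last≡v)))
                             (cong (m ↑ʳ_) (sym b≡w))
                             (Adj-fromSum {inj₁ v} {inj₂ w} cvw)
    lengths : suc (suc (length (embed rg rh))) ≡ length gs + length hs
    lengths = begin
      suc (suc (length (embed rg rh)))    ≡⟨ cong (suc ∘ suc) (length-embed rg rh) ⟩
      suc (suc (length rg + length rh))   ≡⟨ cong suc (ℕ.+-suc (length rg) (length rh)) ⟨
      suc (length rg) + suc (length rh)   ≡⟨ cong₂ _+_ (↭-length gs↭) (↭-length hs↭) ⟨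
      length gs + length hs               ∎
      where open ≡-Reasoning

  -- A Hamiltonian cycle must use vw twice, so it has only the vertices v and w.
  hamiltonianCycle-length≡2 : ∀ s ss → Linked Adj⊎ (s ∷ ss) → Adj⊎ (lastOf s ss) s → Unique (s ∷ ss) →
                              s ∷ ss ↭ allVertices → length (s ∷ ss) ≡ 2
  hamiltonianCycle-length≡2 s ss l closing u p with shape s ss l u
  ... | σ@(inG _) = ⊥-elim ([]≭allFin w (subst (_↭ allFin n) (rights-shape σ) (rights-↭ p)))
  ... | σ@(inH _) = ⊥-elim ([]≭allFin v (subst (_↭ allFin m) (lefts-shape σ) (lefts-↭ p)))
  ... | G→H {a} {A} {b} {B} _ _ last≡v b≡w _
    with cross⇒vw a (lastOf b B)
           (subst (λ t → Adj⊎ t (inj₁ a))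
             (≡.trans (lastOf-++ (inj₁ a) (map inj₁ A) (map inj₂ (b ∷ B))) (lastOf-map inj₂ b B)) closing)
  ...   | a≡v , last≡w
    with lastOf≡head⇒[] a A (Unique.map⁻ (Unique-++⁻ˡ (map inj₁ (a ∷ A)) u)) (≡.trans last≡v (sym a≡v))
       | lastOf≡head⇒[] b B (Unique.map⁻ (Unique-++⁻ʳ (map inj₁ (a ∷ A)) u)) (≡.trans last≡w (sym b≡w))
  ...     | refl | refl = refl
  hamiltonianCycle-length≡2 s ss l closing u p | H→G {b} {B} {a} {A} _ _ last≡w a≡v _
    with cross⇒vw (lastOf a A) b
           (subst (λ t → Adj⊎ t (inj₂ b))
             (≡.trans (lastOf-++ (inj₂ b) (map inj₂ B) (map inj₁ (a ∷ A))) (lastOf-map inj₁ a A)) closing)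
  ...   | last≡v , b≡w
    with lastOf≡head⇒[] a A (Unique.map⁻ (Unique-++⁻ʳ (map inj₂ (b ∷ B)) u)) (≡.trans last≡v (sym a≡v))
       | lastOf≡head⇒[] b B (Unique.map⁻ (Unique-++⁻ˡ (map inj₂ (b ∷ B)) u)) (≡.trans last≡w (sym b≡w))
  ...     | refl | refl = refl

  nonHamiltonian-bridge : 3 ≤ m + n → ¬ Hamiltonian (complete 0 ∗ UG)
  nonHamiltonian-bridge 3≤size (inj₁ size≡1)             = ℕ.<⇒≱ (s≤s (s≤s z≤n)) (subst (3 ≤_) size≡1 3≤size)
  nonHamiltonian-bridge 3≤size (inj₂ (inj₁ (size≡2 , _))) = ℕ.<⇒≱ ℕ.≤-refl (subst (3 ≤_) size≡2 3≤size)
  nonHamiltonian-bridge 3≤size (inj₂ (inj₂ (_ , x , xs , x∷xs↭ , l , closing))) =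
    ℕ.<⇒≱ ℕ.≤-refl (subst (3 ≤_) size≡2 3≤size)
    where
    unique = Unique.map⁺ toSum-injective (Unique-resp-↭ (↭-sym x∷xs↭) (Unique.allFin⁺ (m + n)))
    closing⊎ = subst (λ t → Adj⊎ t (toSum x)) (sym (lastOf-map toSum x xs)) (Adj-toSum closing)
    size≡2 : m + n ≡ 2
    size≡2 = begin
      m + n                      ≡⟨ List.length-tabulate id ⟨
      length (allFin (m + n))    ≡⟨ ↭-length x∷xs↭ ⟨
      length (x ∷ xs)            ≡⟨ List.length-map toSum (x ∷ xs) ⟨
      length (map toSum (x ∷ xs))
        ≡⟨ hamiltonianCycle-length≡2 (toSum x) (map toSum xs) (Linked-toSum l) closing⊎ unique (↭-toSum x∷xs↭) ⟩
      2                          ∎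
      where open ≡-Reasoning

  nonHamiltonian-disconnected : c v w ≡ false → ¬ Hamiltonian (complete 0 ∗ UG)
  nonHamiltonian-disconnected cvw≢ ham with Hamiltonian⇒pathCover≤1 {X = UG} ham
  ... | qs , cover , len≤1 = ℕ.<⇒≱ (s≤s len≤1) (begin
    2                              ≤⟨ ℕ.+-mono-≤ (pathCover-nonempty isCoverG v) (pathCover-nonempty isCoverH w) ⟩
    length coverG + length coverH  ≡⟨ length-uncrossed (uncrossed cvw≢) ⟩
    length qs                      ∎)
    where
    open SplitCover (splitCover cover)
    open ℕ.≤-Reasoning

  module _ {gs hs} (gs-min : IsMinPathCover G gs) (hs-min : IsMinPathCover H hs) where

    length-minCovers≤ : ∀ {qs} (split : SplitCover qs) →
                        length gs + length hs ≤ length (SplitCover.coverG split) + length (SplitCover.coverH split)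
    length-minCovers≤ split =
      ℕ.+-mono-≤ (proj₂ gs-min _ (SplitCover.isCoverG split)) (proj₂ hs-min _ (SplitCover.isCoverH split))

    embed-minimal : c v w ≡ false → IsMinPathCover UG (embed gs hs)
    embed-minimal cvw≢ = embedCover (proj₁ gs-min) (proj₁ hs-min) , minimal
      where
      minimal : ∀ qs → IsPathCover UG qs → length (embed gs hs) ≤ length qs
      minimal qs cover = begin
        length (embed gs hs)           ≡⟨ length-embed gs hs ⟩
        length gs + length hs          ≤⟨ length-minCovers≤ split ⟩
        length coverG + length coverH  ≡⟨ length-uncrossed (uncrossed cvw≢) ⟩
        length qs                      ∎
        where
        split = splitCover cover
        open SplitCover split
        open ℕ.≤-Reasoning

    length-minCover≤ : ∀ {qs} → IsMinPathCover UG qs → length qs ≤ length gs + length hs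
    length-minCover≤ (_ , minimal) =
      ℕ.≤-trans (minimal _ (embedCover (proj₁ gs-min) (proj₁ hs-min))) (ℕ.≤-reflexive (length-embed gs hs))

    length-cover≥ : ∀ {qs} → IsPathCover UG qs → length gs + length hs ≤ suc (length qs)
    length-cover≥ cover = ℕ.≤-trans (length-minCovers≤ split) (SplitCover.length-split≤ split)
      where split = splitCover cover

    terminals⇒length-minCover< : c v w ≡ true → ∀ {qs} → IsMinPathCover UG qs → T v G × T w H →
                                 length qs < length gs + length hs
    terminals⇒length-minCover< cvw {qs} (_ , minimal) ((ps , ps-min , v∈ps) , (ps′ , ps′-min , w∈ps′))
      with joinCover cvw (proj₁ ps-min) v∈ps (proj₁ ps′-min) w∈ps′
    ... | joined , cover , len = begin
      suc (length qs)        ≤⟨ s≤s (minimal joined cover) ⟩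
      suc (length joined)    ≡⟨ len ⟩
      length ps + length ps′ ≡⟨ cong₂ _+_ (minimal-lengths ps-min gs-min) (minimal-lengths ps′-min hs-min) ⟩
      length gs + length hs  ∎
      where open ℕ.≤-Reasoning

    -- If the union needs fewer paths than G and H together, the split of its covering
    -- consists of minimal coverings of G and H and must contain a crossing path.
    length-cover<⇒terminals : ∀ {qs} → IsPathCover UG qs → length qs < length gs + length hs → T v G × T w H
    length-cover<⇒terminals {qs} cover qs< =
      (coverG , minPathCover-≤ gs-min isCoverG (proj₁ parts) , proj₁ terminals) ,
      (coverH , minPathCover-≤ hs-min isCoverH (proj₂ parts) , proj₂ terminals)
      where
      split = splitCover cover
      open SplitCover split
      parts = +-≤-parts (ℕ.≤-trans length-split≤ qs<) (proj₂ gs-min _ isCoverG) (proj₂ hs-min _ isCoverH)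
      crossed≢0 : crossed ≢ 0
      crossed≢0 crossed≡0 =
        ℕ.<⇒≱ qs< (ℕ.≤-trans (length-minCovers≤ split) (ℕ.≤-reflexive (length-uncrossed crossed≡0)))
      terminals = crossed⇒terminals (ℕ.n≢0⇒n>0 crossed≢0)

3≤m+n : ∀ {m n} → Fin m → Fin n → ¬ (m ≡ 1 × n ≡ 1) → 3 ≤ m + n
3≤m+n {suc zero}    {suc zero}    _ _ ¬K₁K₁ = ⊥-elim (¬K₁K₁ (refl , refl))
3≤m+n {suc zero}    {suc (suc _)} _ _ _     = s≤s (s≤s (s≤s z≤n))
3≤m+n {suc (suc m)} {suc n}       _ _ _     = s≤s (s≤s (ℕ.≤-trans (s≤s z≤n) (ℕ.m≤n+m (suc n) m)))

length-minPathCover-K₁ : ∀ {X : Graph 1} {ps} → IsMinPathCover X ps → length ps ≡ 1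
length-minPathCover-K₁ (cover , _) = ℕ.≤-antisym (length-pathCover≤ cover) (pathCover-nonempty cover Fin.zero)

module _ {m n : ℕ} (G : Graph m) (H : Graph n) (v : Fin m) (w : Fin n) where

  -- Spelled as in unionPlusEdge, so that unionPlusEdge G H v w is WithEdge.UG by definition.
  vw : Fin m → Fin n → Bool
  vw i j = ⌊ i Fin.≟ v ⌋ ∧ ⌊ j Fin.≟ w ⌋

  vw⇒≡ : ∀ i j → vw i j ≡ true → i ≡ v × j ≡ w
  vw⇒≡ i j e with i Fin.≟ v | j Fin.≟ w
  vw⇒≡ i j e  | yes i≡v | yes j≡w = i≡v , j≡w
  vw⇒≡ i j () | yes _   | no _
  vw⇒≡ i j () | no _    | _

  vw-edge : vw v w ≡ true
  vw-edge with v Fin.≟ v | w Fin.≟ w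
  ... | yes _   | yes _   = refl
  ... | no v≢v  | _       = ⊥-elim (v≢v refl)
  ... | yes _   | no w≢w  = ⊥-elim (w≢w refl)

  module WithEdge = Bridge G H vw v w vw⇒≡
  module Disjoint = Bridge G H (λ _ _ → false) v w (λ _ _ ())

  isMuCheck-⊔ : ∀ {gs hs} → IsMinPathCover G gs → IsMinPathCover H hs →
                IsMuCheck (G ⊔ H) (length gs + length hs)
  isMuCheck-⊔ {gs} {hs} gs-min hs-min =
    subst (IsMuCheck (G ⊔ H)) (Disjoint.length-embed gs hs)
      (isMuCheck-minPathCover (G ⊔ H) (Disjoint.embed-minimal gs-min hs-min refl) (v ↑ˡ n)
        (Disjoint.nonHamiltonian-disconnected refl))

isMuCheck-K₂ : (G H : Graph 1) (v w : Fin 1) → IsMuCheck (unionPlusEdge G H v w) 0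
isMuCheck-K₂ G H v w =
  inj₂ (inj₁ (refl , v ↑ˡ 1 , 1 ↑ʳ w , WithEdge.Adj-fromSum G H v w {inj₁ v} {inj₂ w} (vw-edge G H v w))) ,
  λ _ ()

corollary2p8 : ∀ {m n} (G : Graph m) (H : Graph n) (v : Fin m) (w : Fin n) →
    ∃[ a ] ∃[ b ] IsMuCheck (unionPlusEdge G H v w) a × IsMuCheck (G ⊔ H) b
      × ((m ≡ 1 × n ≡ 1) → a + 2 ≡ b)
      × (¬ (m ≡ 1 × n ≡ 1) → T v G × T w H → a + 1 ≡ b)
      × (¬ (m ≡ 1 × n ≡ 1) → ¬ (T v G × T w H) → a ≡ b)
corollary2p8 {m} {n} G H v w with minPathCover G | minPathCover H
... | gs , gs-min | hs , hs-min with (m ℕ.≟ 1) ×-dec (n ℕ.≟ 1)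
...   | yes (refl , refl) =
  0 , length gs + length hs , isMuCheck-K₂ G H v w , isMuCheck-⊔ G H v w gs-min hs-min ,
  (λ _ → sym (cong₂ _+_ (length-minPathCover-K₁ gs-min) (length-minPathCover-K₁ hs-min))) ,
  (λ ¬K₁K₁ → ⊥-elim (¬K₁K₁ (refl , refl))) , (λ ¬K₁K₁ → ⊥-elim (¬K₁K₁ (refl , refl)))
...   | no ¬K₁K₁ with minPathCover (unionPlusEdge G H v w)
...     | qs , qs-min =
  length qs , length gs + length hs ,
  isMuCheck-minPathCover _ qs-min (v ↑ˡ n) (nonHamiltonian-bridge (3≤m+n v w ¬K₁K₁)) ,
  isMuCheck-⊔ G H v w gs-min hs-min ,
  (λ K₁K₁ → ⊥-elim (¬K₁K₁ K₁K₁)) ,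
  (λ _ terminals → ≡.trans (ℕ.+-comm (length qs) 1) (ℕ.≤-antisym
     (terminals⇒length-minCover< gs-min hs-min (vw-edge G H v w) qs-min terminals)
     (length-cover≥ gs-min hs-min (proj₁ qs-min)))) ,
  (λ _ ¬terminals → ℕ.≤-antisym
     (length-minCover≤ gs-min hs-min qs-min)
     (ℕ.≮⇒≥ (¬terminals ∘ length-cover<⇒terminals gs-min hs-min (proj₁ qs-min))))
  where open WithEdge G H v w
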